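{- Let $V_3$ be a $3$-dimensional subspace of $\mathbb{F}_3^4$ and $H=\{A_\lambda:\lambda\in V_3\}\cong(Z_3)^3$. The three $27$-sets $\mathcal{R}_H,\mathcal{R}'_H,\mathcal{R}''_H$ are all Segre varieties $\mathcal{S}_3(2)$ if and only if the projective plane $\mathbb{P}V_3\subset\operatorname{PG}(3,3)$ is of kind $\mathcal{P}_0$, i.e. contains none of the four points $\langle1000\rangle,\langle0100\rangle,\langle0010\rangle,\langle0001\rangle$. Consequently the $81$-set $\omega_4$ contains precisely $24$ copies of a Segre variety $\mathcal{S}_3(2)$.
   Context: Work over $\mathbb{F}_2$. $V_8=V(8,2)$ with basis $e_1,\dots,e_8$, $V_a=\langle e_1,e_8\rangle$, $V_b=\langle e_2,e_7\rangle$, $V_c=\langle e_3,e_6\rangle$, $V_d=\langle e_4,e_5\rangle$; points of $\operatorname{PG}(7,2)$ are nonzero vectors; $\omega_4$ is the set of vectors all four of whose components in $V_a,\dots,V_d$ are nonzero. Let $\zeta_a: e_1\mapsto e_8\mapsto e_1+e_8\mapsto e_1$, $\zeta_b: e_7\mapsto e_2\mapsto e_2+e_7\mapsto e_7$, $\zeta_c: e_3\mapsto e_6\mapsto e_3+e_6\mapsto e_3$, $\zeta_d: e_5\mapsto e_4\mapsto e_4+e_5\mapsto e_5$. For $\lambda=ijkl\in\mathbb{F}_3^4$ let $A_\lambda=\zeta_a^i\oplus\zeta_b^j\oplus\zeta_c^k\oplus\zeta_d^l$; $\lambda\mapsto A_\lambda$ is an isomorphism of $(\mathbb{F}_3^4,+)$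 onto a group $\mathcal{G}_{81}\cong(Z_3)^4$. Let $u=e_1+\dots+e_8$; then $\omega_4=\{A_\lambda u:\lambda\in\mathbb{F}_3^4\}$ bijectively. For a subgroup $H\cong(Z_3)^3$ of $\mathcal{G}_{81}$ with cosets $H,H',H''$, set $\mathcal{R}_H=\{hu:h\in H\}$, $\mathcal{R}'_H=\{hu:h\in H'\}$, $\mathcal{R}''_H=\{hu:h\in H''\}$, a partition of $\omega_4$ into three $27$-sets. A Segre variety $\mathcal{S}_3(2)$ in $\operatorname{PG}(7,2)$ is the image, under some linear isomorphism $V(2,2)\otimes V(2,2)\otimes V(2,2)\to V_8$, of the set of nonzero pure tensors $\{x\otimes y\otimes z\}$ ($27$ points). -}

module Defs where

open import Level using (0ℓ)
open import Data.Bool using (Bool; true; false; _xor_; _∧_; _∨_)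
open import Data.Fin using (Fin; zero; suc)
open import Data.Vec using (Vec; []; _∷_; map; zipWith; foldr; replicate)
open import Data.Product using (Σ; _×_; _,_; ∃; ∃-syntax)
open import Relation.Binary.PropositionalEquality using (_≡_; _≢_)
open import Relation.Nullary using (¬_)
open import Function.Bundles using (_⇔_)

F3 : Set
F3 = Fin 3

_+₃_ : F3 → F3 → F3
zero +₃ y = y
suc zero +₃ zero = suc zero
suc zero +₃ suc zero = suc (suc zero)
suc zero +₃ suc (suc zero) = zero
suc (suc zero) +₃ zero = suc (suc zero)
suc (suc zero) +₃ suc zero = zero
suc (suc zero) +₃ suc (suc zero) = suc zero

_*₃_ : F3 → F3 → F3
zero *₃ y = zero
suc zero *₃ y = y
suc (suc zero) *₃ y = y +₃ y

F3⁴ : Set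
F3⁴ = Vec F3 4

_+ᵥ_ : F3⁴ → F3⁴ → F3⁴
_+ᵥ_ = zipWith _+₃_

_·ᵥ_ : F3 → F3⁴ → F3⁴
c ·ᵥ v = map (c *₃_) v

0ᵥ : F3⁴
0ᵥ = replicate 4 zero

lc : F3 → F3 → F3 → F3⁴ → F3⁴ → F3⁴ → F3⁴
lc c1 c2 c3 v1 v2 v3 = ((c1 ·ᵥ v1) +ᵥ (c2 ·ᵥ v2)) +ᵥ (c3 ·ᵥ v3)

LinIndep3 : F3⁴ → F3⁴ → F3⁴ → Set
LinIndep3 v1 v2 v3 =
  ∀ c1 c2 c3 → lc c1 c2 c3 v1 v2 v3 ≡ 0ᵥ → (c1 ≡ zero) × (c2 ≡ zero) × (c3 ≡ zero)

InSpan : F3⁴ → F3⁴ → F3⁴ → F3⁴ → Set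
InSpan v1 v2 v3 λ' = ∃[ c1 ] ∃[ c2 ] ∃[ c3 ] (λ' ≡ lc c1 c2 c3 v1 v2 v3)

1₃ : F3
1₃ = suc zero

p1000 p0100 p0010 p0001 : F3⁴
p1000 = 1₃ ∷ zero ∷ zero ∷ zero ∷ []
p0100 = zero ∷ 1₃ ∷ zero ∷ zero ∷ []
p0010 = zero ∷ zero ∷ 1₃ ∷ zero ∷ []
p0001 = zero ∷ zero ∷ zero ∷ 1₃ ∷ []

KindP0 : F3⁴ → F3⁴ → F3⁴ → Set
KindP0 v1 v2 v3 =
  ¬ InSpan v1 v2 v3 p1000 × ¬ InSpan v1 v2 v3 p0100 ×
  ¬ InSpan v1 v2 v3 p0010 × ¬ InSpan v1 v2 v3 p0001

V8 : Set
V8 = Vec Bool 8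

-- ζ_a : e1 ↦ e8 ↦ e1+e8 ↦ e1   (acts on V_a = ⟨e1,e8⟩, identity elsewhere)
ζa : V8 → V8
ζa (x1 ∷ x2 ∷ x3 ∷ x4 ∷ x5 ∷ x6 ∷ x7 ∷ x8 ∷ []) =
  x8 ∷ x2 ∷ x3 ∷ x4 ∷ x5 ∷ x6 ∷ x7 ∷ (x1 xor x8) ∷ []

-- ζ_b : e7 ↦ e2 ↦ e2+e7 ↦ e7
ζb : V8 → V8
ζb (x1 ∷ x2 ∷ x3 ∷ x4 ∷ x5 ∷ x6 ∷ x7 ∷ x8 ∷ []) =
  x1 ∷ (x2 xor x7) ∷ x3 ∷ x4 ∷ x5 ∷ x6 ∷ x2 ∷ x8 ∷ []

-- ζ_c : e3 ↦ e6 ↦ e3+e6 ↦ e3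
ζc : V8 → V8
ζc (x1 ∷ x2 ∷ x3 ∷ x4 ∷ x5 ∷ x6 ∷ x7 ∷ x8 ∷ []) =
  x1 ∷ x2 ∷ x6 ∷ x4 ∷ x5 ∷ (x3 xor x6) ∷ x7 ∷ x8 ∷ []

-- ζ_d : e5 ↦ e4 ↦ e4+e5 ↦ e5
ζd : V8 → V8
ζd (x1 ∷ x2 ∷ x3 ∷ x4 ∷ x5 ∷ x6 ∷ x7 ∷ x8 ∷ []) =
  x1 ∷ x2 ∷ x3 ∷ (x4 xor x5) ∷ x4 ∷ x6 ∷ x7 ∷ x8 ∷ []

pow : F3 → (V8 → V8) → V8 → V8
pow zero f v = v
pow (suc zero) f v = f v
pow (suc (suc zero)) f v = f (f v)

A : F3⁴ → V8 → V8
A (i ∷ j ∷ k ∷ l ∷ []) v = pow i ζa (pow j ζb (pow k ζc (pow l ζd v)))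

u : V8
u = replicate 8 true

-- ω_4 : all four components in V_a, V_b, V_c, V_d nonzero
InΩ4 : V8 → Set
InΩ4 (x1 ∷ x2 ∷ x3 ∷ x4 ∷ x5 ∷ x6 ∷ x7 ∷ x8 ∷ []) =
  ((x1 ∨ x8) ∧ (x2 ∨ x7) ∧ (x3 ∨ x6) ∧ (x4 ∨ x5)) ≡ true

PointSet : Set₁
PointSet = V8 → Set

_⊆_ : PointSet → PointSet → Set
S ⊆ T = ∀ p → S p → T p

SameSet : PointSet → PointSet → Set
SameSet S T = ∀ p → S p ⇔ T p

-- 8×8 matrices over F_2 (list of rows), acting on column vectors
Mat : Set
Mat = Vec V8 8

dot : V8 → V8 → Bool
dot r v = foldr _ _xor_ false (zipWith _∧_ r v)

apply : Mat → V8 → V8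
apply M v = map (λ r → dot r v) M

Invertible : Mat → Set
Invertible M = ∃[ N ] ((∀ v → apply N (apply M v) ≡ v) × (∀ v → apply M (apply N v) ≡ v))

V2 : Set
V2 = Vec Bool 2

Nonzero2 : V2 → Set
Nonzero2 (a ∷ b ∷ []) = (a ∨ b) ≡ true

-- coordinates of x ⊗ y ⊗ z in the basis e_i ⊗ e_j ⊗ e_k, (i,j,k) in lexicographic order
tensor : V2 → V2 → V2 → V8
tensor (x0 ∷ x1 ∷ []) (y0 ∷ y1 ∷ []) (z0 ∷ z1 ∷ []) =
  (x0 ∧ y0 ∧ z0) ∷ (x0 ∧ y0 ∧ z1) ∷ (x0 ∧ y1 ∧ z0) ∷ (x0 ∧ y1 ∧ z1) ∷
  (x1 ∧ y0 ∧ z0) ∷ (x1 ∧ y0 ∧ z1) ∷ (x1 ∧ y1 ∧ z0) ∷ (x1 ∧ y1 ∧ z1) ∷ []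

SegreImage : Mat → PointSet
SegreImage M p =
  ∃[ x ] ∃[ y ] ∃[ z ] (Nonzero2 x × Nonzero2 y × Nonzero2 z × (p ≡ apply M (tensor x y z)))

IsSegre : PointSet → Set
IsSegre S = ∃[ M ] (Invertible M × SameSet S (SegreImage M))

-- The 27-set {A_λ u : λ ∈ μ + V_3} (μ ranges over coset representatives,
-- giving R_H, R'_H, R''_H)

CosetSet : F3⁴ → F3⁴ → F3⁴ → F3⁴ → PointSet
CosetSet v1 v2 v3 μ p = ∃[ w ] (InSpan v1 v2 v3 w × (p ≡ A (μ +ᵥ w) u))

Exactly24SegreInΩ4 : Set₁
Exactly24SegreInΩ4 =
  Σ (Fin 24 → PointSet) λ L →
    (∀ i → IsSegre (L i) × (L i ⊆ InΩ4)) ×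
    (∀ i j → i ≢ j → ¬ SameSet (L i) (L j)) ×
    (∀ S → IsSegre S → S ⊆ InΩ4 → ∃[ i ] SameSet S (L i))

-- λ ↦ A_λ u identifies F₃⁴ with ω₄, and the sets R_H, R′_H, R″_H with the cosets of V₃.
-- Let M be the matrix of a Segre variety lying in ω₄. Its rows come in four pairs, one for each of
-- V_a, …, V_d, and each pair must be nonzero on every pure tensor x ⊗ y ⊗ z. An exhaustive search
-- shows that such a pair is x ⊗ y ⊗ z ↦ point (α ± code x ± code y ± code z), where code and point
-- identify the nonzero vectors of V(2,2) with F₃; so the variety is the image of an affine map F₃³ → F₃⁴.
-- Over F₂ two pairs whose sign patterns are proportional have linearly dependent rows, so the four
-- patterns are pairwise non-proportional; then the image is a coset of a plane whose normal has no zero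
-- entry, i.e. a plane of kind P₀. Conversely each of the 8 × 3 cosets of the planes of kind P₀ is
-- realised by an explicit invertible block matrix. Finally a 3-dimensional V₃ is the kernel of a
-- normal n (pigeonhole), and V₃ is of kind P₀ exactly when n has no zero entry.
module Submission where

open import Defs
open import Level using (0ℓ)
open import Data.Bool using (Bool; true; false; _∨_)
import Data.Bool.Properties as Bool
open import Data.Bool.ListAction using (all; any)
open import Data.Empty using (⊥-elim)
open import Data.Fin using (Fin; zero; suc; #_; combine; remQuot; punchOut; opposite)
open import Data.Fin.Properties using (_≟_; any?; remQuot-combine; combine-remQuot; punchOut-injective; injective⇒≤; <⇒≢)
import Data.Fin.Properties as Fin
open import Data.List using (List; []; _∷_; allFin; cartesianProduct; cartesianProductWith; find)
open import Data.List.Membership.Propositional using (_∈_)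
open import Data.List.Membership.Propositional.Properties using (∈-allFin; ∈-cartesianProduct⁺; ∈-cartesianProductWith⁺)
import Data.List.Relation.Unary.All as All
open import Data.List.Relation.Unary.All.Properties using (all⁺; all⁻)
import Data.List.Relation.Unary.Any as Any
open import Data.List.Relation.Unary.Any using (here; there)
open import Data.List.Relation.Unary.Any.Properties using (any⁺; any⁻)
open import Data.Maybe using (fromMaybe)
open import Data.Nat using (ℕ; _^_; _<_; _<?_)
open import Data.Nat.Properties using (1+n≰n)
open import Data.Product using (∃; ∃₂; _×_; _,_; proj₁; proj₂)
import Data.Product.Properties as Product
open import Data.Sum using (_⊎_)
open import Data.Vec using (Vec; []; _∷_; map; zipWith; replicate; lookup; head; tabulate; transpose; _++_; _[_]≔_)
import Data.Vec.Properties as Vec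
open import Function using (_∘_)
open import Function.Bundles using (_⇔_; mk⇔; Equivalence)
import Function.Properties.Equivalence as ⇔
open import Relation.Binary.PropositionalEquality using (_≡_; _≢_; refl; sym; trans; cong; cong₂; subst; subst₂; module ≡-Reasoning)
open import Relation.Nullary using (Dec; ¬_; yes; no; contradiction)
open import Relation.Nullary.Decidable using (map′; from-yes; isYes; T?; toWitness; fromWitness; _→-dec_; _×-dec_; _⊎-dec_; ¬?)
open import Relation.Unary using (Pred; Decidable)

private
  variable
    m n k : ℕ

record Enumeration (A : Set) : Set where
  field
    elements : List A
    complete : ∀ x → x ∈ elements

open Enumeration ⦃ ... ⦄

-- Decided by a Boolean scan whose outcome is turned into a proof afterwards; this keeps the
-- large searches below cheap.
module _ {A : Set} ⦃ _ : Enumeration A ⦄ {P : Pred A 0ℓ} where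

  ∀? : Decidable P → Dec (∀ x → P x)
  ∀? P? = map′ (λ h x → toWitness {a? = P? x} (All.lookup (all⁺ (isYes ∘ P?) elements h) (complete x)))
               (λ f → all⁻ (isYes ∘ P?) {xs = elements} (All.tabulate λ {x} _ → fromWitness (f x)))
               (T? (all (isYes ∘ P?) elements))

  ∃? : Decidable P → Dec (∃ P)
  ∃? P? = map′ (λ h → let x , px = Any.satisfied (any⁻ (isYes ∘ P?) elements h) in x , toWitness {a? = P? x} px)
               (λ (x , px) → any⁺ (isYes ∘ P?) (Any.map (λ { refl → fromWitness px }) (complete x)))
               (T? (any (isYes ∘ P?) elements))

instance
  Bool-enumeration : Enumeration Bool
  Bool-enumeration = record
    { elements = true ∷ false ∷ []
    ; complete = λ { true → here refl ; false → there (here refl) } }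

  Fin-enumeration : Enumeration (Fin n)
  Fin-enumeration {n} = record { elements = allFin n ; complete = ∈-allFin }

  ×-enumeration : ∀ {A B : Set} → ⦃ Enumeration A ⦄ → ⦃ Enumeration B ⦄ → Enumeration (A × B)
  ×-enumeration = record
    { elements = cartesianProduct elements elements
    ; complete = λ (x , y) → ∈-cartesianProduct⁺ (complete x) (complete y) }

  Vec-enumeration : ∀ {A : Set} → ⦃ Enumeration A ⦄ → Enumeration (Vec A n)
  Vec-enumeration {A = A} = record { elements = vectors _ ; complete = vectors-complete }
    where
    vectors : ∀ n → List (Vec A n)
    vectors ℕ.zero    = [] ∷ []
    vectors (ℕ.suc n) = cartesianProductWith _∷_ elements (vectors n)
    vectors-complete : (xs : Vec A n) → xs ∈ vectors n
    vectors-complete []       = here refl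
    vectors-complete (x ∷ xs) = ∈-cartesianProductWith⁺ _∷_ (complete x) (vectors-complete xs)

toFin : Vec (Fin m) n → Fin (m ^ n)
toFin []       = zero
toFin (x ∷ xs) = combine x (toFin xs)

fromFin : ∀ n → Fin (m ^ n) → Vec (Fin m) n
fromFin         ℕ.zero    _ = []
fromFin {m = m} (ℕ.suc n) i = proj₁ (remQuot {m} (m ^ n) i) ∷ fromFin n (proj₂ (remQuot {m} (m ^ n) i))

fromFin-toFin : (xs : Vec (Fin m) n) → fromFin n (toFin xs) ≡ xs
fromFin-toFin [] = refl
fromFin-toFin {m} {ℕ.suc n} (x ∷ xs) =
  trans (cong (λ (y , i) → y ∷ fromFin n i) (remQuot-combine {m} {m ^ n} x (toFin xs)))
        (cong (x ∷_) (fromFin-toFin xs))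

toFin-fromFin : ∀ n (i : Fin (m ^ n)) → toFin (fromFin n i) ≡ i
toFin-fromFin ℕ.zero zero = refl
toFin-fromFin {m} (ℕ.suc n) i =
  trans (cong (combine {m} (proj₁ (remQuot {m} (m ^ n) i))) (toFin-fromFin n (proj₂ (remQuot {m} (m ^ n) i))))
        (combine-remQuot {m} (m ^ n) i)

toFin-injective : {xs ys : Vec (Fin m) n} → toFin xs ≡ toFin ys → xs ≡ ys
toFin-injective {xs = xs} {ys} eq =
  trans (sym (fromFin-toFin xs)) (trans (cong (fromFin _) eq) (fromFin-toFin ys))

fromFin-injective : ∀ n {i j : Fin (m ^ n)} → fromFin n i ≡ fromFin n j → i ≡ j
fromFin-injective n {i} {j} eq = trans (sym (toFin-fromFin n i)) (trans (cong toFin eq) (toFin-fromFin n j))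

fin-injective⇒surjective : (f : Fin n → Fin n) → (∀ {i j} → f i ≡ f j → i ≡ j) → ∀ j → ∃ λ i → f i ≡ j
fin-injective⇒surjective {ℕ.suc n} f f-injective j with any? (λ i → f i ≟ j)
... | yes hit = hit
... | no miss = contradiction (injective⇒≤ squeeze-injective) (1+n≰n {n})
  where
  avoids : ∀ i → j ≢ f i
  avoids i j≡fi = miss (i , sym j≡fi)
  squeeze : Fin (ℕ.suc n) → Fin n
  squeeze i = punchOut (avoids i)
  squeeze-injective : ∀ {i i′} → squeeze i ≡ squeeze i′ → i ≡ i′
  squeeze-injective eq = f-injective (punchOut-injective (avoids _) (avoids _) eq)

injective⇒surjective : (f : Vec (Fin m) n → Vec (Fin m) n) → (∀ {x y} → f x ≡ f y → x ≡ y) →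
                       ∀ y → ∃ λ x → f x ≡ y
injective⇒surjective {n = n} f f-injective y =
  let i , gi≡y = fin-injective⇒surjective g g-injective (toFin y) in fromFin n i , toFin-injective gi≡y
  where
  g : Fin _ → Fin _
  g i = toFin (f (fromFin n i))
  g-injective : ∀ {i j} → g i ≡ g j → i ≡ j
  g-injective eq = fromFin-injective n (f-injective (toFin-injective eq))

pigeonhole : m ^ k < m ^ n → (f : Vec (Fin m) n → Vec (Fin m) k) → ∃₂ λ x y → x ≢ y × f x ≡ f y
pigeonhole {n = n} k<n f with i , j , i<j , gi≡gj ← Fin.pigeonhole k<n (λ i → toFin (f (fromFin n i))) =
  fromFin n i , fromFin n j , (λ eq → <⇒≢ i<j (fromFin-injective n eq)) , toFin-injective gi≡gj

-1₃ : F3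
-1₃ = suc (suc zero)

_-₃_ : F3 → F3 → F3
a -₃ b = a +₃ (-1₃ *₃ b)

-- Proved by exhaustion; opaque so that unification never re-runs the searches.
opaque
  +₃-identityʳ : ∀ a → a +₃ zero ≡ a
  +₃-identityʳ = from-yes (∀? λ a → a +₃ zero ≟ a)

  +₃-interchange : ∀ a b c d → (a +₃ b) +₃ (c +₃ d) ≡ (a +₃ c) +₃ (b +₃ d)
  +₃-interchange = from-yes (∀? λ a → ∀? λ b → ∀? λ c → ∀? λ d → (a +₃ b) +₃ (c +₃ d) ≟ (a +₃ c) +₃ (b +₃ d))

  +₃-cancelʳ : ∀ a b c → a +₃ c ≡ b +₃ c → a ≡ b
  +₃-cancelʳ = from-yes (∀? λ a → ∀? λ b → ∀? λ c → a +₃ c ≟ b +₃ c →-dec a ≟ b)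

  *₃-comm : ∀ a b → a *₃ b ≡ b *₃ a
  *₃-comm = from-yes (∀? λ a → ∀? λ b → a *₃ b ≟ b *₃ a)

  *₃-zeroʳ : ∀ a → a *₃ zero ≡ zero
  *₃-zeroʳ = from-yes (∀? λ a → a *₃ zero ≟ zero)

  *₃-leftComm : ∀ a b c → a *₃ (b *₃ c) ≡ b *₃ (a *₃ c)
  *₃-leftComm = from-yes (∀? λ a → ∀? λ b → ∀? λ c → a *₃ (b *₃ c) ≟ b *₃ (a *₃ c))

  *₃-distribˡ : ∀ a b c → a *₃ (b +₃ c) ≡ (a *₃ b) +₃ (a *₃ c)
  *₃-distribˡ = from-yes (∀? λ a → ∀? λ b → ∀? λ c → a *₃ (b +₃ c) ≟ (a *₃ b) +₃ (a *₃ c))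

  *₃-cancelʳ : ∀ a b c → c ≢ zero → a *₃ c ≡ b *₃ c → a ≡ b
  *₃-cancelʳ = from-yes (∀? λ a → ∀? λ b → ∀? λ c → ¬? (c ≟ zero) →-dec (a *₃ c ≟ b *₃ c →-dec a ≟ b))

  x-x≡0 : ∀ a → a -₃ a ≡ zero
  x-x≡0 = from-yes (∀? λ a → a -₃ a ≟ zero)

  x-y≡0⇒x≡y : ∀ a b → a -₃ b ≡ zero → a ≡ b
  x-y≡0⇒x≡y = from-yes (∀? λ a → ∀? λ b → a -₃ b ≟ zero →-dec a ≟ b)

  x+[y-x]≡y : ∀ a b → a +₃ (b -₃ a) ≡ b
  x+[y-x]≡y = from-yes (∀? λ a → ∀? λ b → a +₃ (b -₃ a) ≟ b)

  [x-y]z≡xz-yz : ∀ a b c → (a -₃ b) *₃ c ≡ (a *₃ c) -₃ (b *₃ c)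
  [x-y]z≡xz-yz = from-yes (∀? λ a → ∀? λ b → ∀? λ c → (a -₃ b) *₃ c ≟ (a *₃ c) -₃ (b *₃ c))

  -₃-interchange : ∀ a b c d → (a -₃ b) +₃ (c -₃ d) ≡ (a +₃ c) -₃ (b +₃ d)
  -₃-interchange = from-yes (∀? λ a → ∀? λ b → ∀? λ c → ∀? λ d → (a -₃ b) +₃ (c -₃ d) ≟ (a +₃ c) -₃ (b +₃ d))

  -1₃-involutive : ∀ a → -1₃ *₃ (-1₃ *₃ a) ≡ a
  -1₃-involutive = from-yes (∀? λ a → -1₃ *₃ (-1₃ *₃ a) ≟ a)

  -1₃-affine : ∀ β w₁ w₂ w₃ c₁ c₂ c₃ →
    -1₃ *₃ (β +₃ (((c₁ *₃ w₁) +₃ (c₂ *₃ w₂)) +₃ (c₃ *₃ w₃)))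
      ≡ (-1₃ *₃ β) +₃ (((c₁ *₃ (-1₃ *₃ w₁)) +₃ (c₂ *₃ (-1₃ *₃ w₂))) +₃ (c₃ *₃ (-1₃ *₃ w₃)))
  -1₃-affine = from-yes (∀? λ β → ∀? λ w₁ → ∀? λ w₂ → ∀? λ w₃ → ∀? λ c₁ → ∀? λ c₂ → ∀? λ c₃ →
    -1₃ *₃ (β +₃ (((c₁ *₃ w₁) +₃ (c₂ *₃ w₂)) +₃ (c₃ *₃ w₃)))
      ≟ (-1₃ *₃ β) +₃ (((c₁ *₃ (-1₃ *₃ w₁)) +₃ (c₂ *₃ (-1₃ *₃ w₂))) +₃ (c₃ *₃ (-1₃ *₃ w₃))))


⟨_,_⟩ : Vec F3 n → Vec F3 n → F3
⟨ [] , [] ⟩ = zero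
⟨ a ∷ as , b ∷ bs ⟩ = (a *₃ b) +₃ ⟨ as , bs ⟩

_-ᵥ_ : Vec F3 n → Vec F3 n → Vec F3 n
a -ᵥ b = zipWith _+₃_ a (map (-1₃ *₃_) b)

⟨⟩-comm : (a b : Vec F3 n) → ⟨ a , b ⟩ ≡ ⟨ b , a ⟩
⟨⟩-comm [] [] = refl
⟨⟩-comm (a ∷ as) (b ∷ bs) = cong₂ _+₃_ (*₃-comm a b) (⟨⟩-comm as bs)

⟨⟩-+ : (m a b : Vec F3 n) → ⟨ m , zipWith _+₃_ a b ⟩ ≡ ⟨ m , a ⟩ +₃ ⟨ m , b ⟩
⟨⟩-+ [] [] [] = refl
⟨⟩-+ (m ∷ ms) (a ∷ as) (b ∷ bs) = begin
  (m *₃ (a +₃ b)) +₃ ⟨ ms , zipWith _+₃_ as bs ⟩         ≡⟨ cong₂ _+₃_ (*₃-distribˡ m a b) (⟨⟩-+ ms as bs) ⟩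
  ((m *₃ a) +₃ (m *₃ b)) +₃ (⟨ ms , as ⟩ +₃ ⟨ ms , bs ⟩) ≡⟨ +₃-interchange (m *₃ a) (m *₃ b) ⟨ ms , as ⟩ ⟨ ms , bs ⟩ ⟩
  ((m *₃ a) +₃ ⟨ ms , as ⟩) +₃ ((m *₃ b) +₃ ⟨ ms , bs ⟩) ∎
  where open ≡-Reasoning

⟨⟩-· : (m : Vec F3 n) (c : F3) (a : Vec F3 n) → ⟨ m , map (c *₃_) a ⟩ ≡ c *₃ ⟨ m , a ⟩
⟨⟩-· [] c [] = sym (*₃-zeroʳ c)
⟨⟩-· (m ∷ ms) c (a ∷ as) = begin
  (m *₃ (c *₃ a)) +₃ ⟨ ms , map (c *₃_) as ⟩ ≡⟨ cong₂ _+₃_ (*₃-leftComm m c a) (⟨⟩-· ms c as) ⟩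
  (c *₃ (m *₃ a)) +₃ (c *₃ ⟨ ms , as ⟩)      ≡⟨ sym (*₃-distribˡ c (m *₃ a) ⟨ ms , as ⟩) ⟩
  c *₃ ((m *₃ a) +₃ ⟨ ms , as ⟩)             ∎
  where open ≡-Reasoning

⟨⟩--ᵥ : (m a b : Vec F3 n) → ⟨ m , a -ᵥ b ⟩ ≡ ⟨ m , a ⟩ -₃ ⟨ m , b ⟩
⟨⟩--ᵥ m a b = trans (⟨⟩-+ m a _) (cong (⟨ m , a ⟩ +₃_) (⟨⟩-· m -1₃ b))

x-ᵥx≡0 : (a : Vec F3 n) → a -ᵥ a ≡ replicate n zero
x-ᵥx≡0 [] = refl
x-ᵥx≡0 (a ∷ as) = cong₂ _∷_ (x-x≡0 a) (x-ᵥx≡0 as)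

x-ᵥy≡0⇒x≡y : (a b : Vec F3 n) → a -ᵥ b ≡ replicate n zero → a ≡ b
x-ᵥy≡0⇒x≡y [] [] _ = refl
x-ᵥy≡0⇒x≡y (a ∷ as) (b ∷ bs) eq =
  cong₂ _∷_ (x-y≡0⇒x≡y a b (Vec.∷-injectiveˡ eq)) (x-ᵥy≡0⇒x≡y as bs (Vec.∷-injectiveʳ eq))

+ᵥ-cancelʳ : (a b c : Vec F3 n) → zipWith _+₃_ a c ≡ zipWith _+₃_ b c → a ≡ b
+ᵥ-cancelʳ [] [] [] _ = refl
+ᵥ-cancelʳ (a ∷ as) (b ∷ bs) (c ∷ cs) eq =
  cong₂ _∷_ (+₃-cancelʳ a b c (Vec.∷-injectiveˡ eq)) (+ᵥ-cancelʳ as bs cs (Vec.∷-injectiveʳ eq))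

x+ᵥ[y-ᵥx]≡y : (a b : Vec F3 n) → zipWith _+₃_ a (b -ᵥ a) ≡ b
x+ᵥ[y-ᵥx]≡y [] [] = refl
x+ᵥ[y-ᵥx]≡y (a ∷ as) (b ∷ bs) = cong₂ _∷_ (x+[y-x]≡y a b) (x+ᵥ[y-ᵥx]≡y as bs)

x+ᵥ0·y≡x : (a x : Vec F3 n) → zipWith _+₃_ a (map (zero *₃_) x) ≡ a
x+ᵥ0·y≡x [] [] = refl
x+ᵥ0·y≡x (a ∷ as) (_ ∷ xs) = cong₂ _∷_ (+₃-identityʳ a) (x+ᵥ0·y≡x as xs)

_≟ᵥ_ : (a b : F3⁴) → Dec (a ≡ b)
_≟ᵥ_ = Vec.≡-dec _≟_

Orthogonal : F3⁴ → F3⁴ → F3⁴ → F3⁴ → Set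
Orthogonal n v₁ v₂ v₃ = ⟨ n , v₁ ⟩ ≡ zero × ⟨ n , v₂ ⟩ ≡ zero × ⟨ n , v₃ ⟩ ≡ zero

orthogonal? : ∀ n v₁ v₂ v₃ → Dec (Orthogonal n v₁ v₂ v₃)
orthogonal? n v₁ v₂ v₃ = (⟨ n , v₁ ⟩ ≟ zero) ×-dec (⟨ n , v₂ ⟩ ≟ zero) ×-dec (⟨ n , v₃ ⟩ ≟ zero)

linIndep3? : ∀ v₁ v₂ v₃ → Dec (LinIndep3 v₁ v₂ v₃)
linIndep3? v₁ v₂ v₃ = ∀? λ c₁ → ∀? λ c₂ → ∀? λ c₃ →
  (lc c₁ c₂ c₃ v₁ v₂ v₃ ≟ᵥ 0ᵥ) →-dec ((c₁ ≟ zero) ×-dec (c₂ ≟ zero) ×-dec (c₃ ≟ zero))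

0∈span : ∀ v₁ v₂ v₃ → InSpan v₁ v₂ v₃ 0ᵥ
0∈span (_ ∷ _ ∷ _ ∷ _ ∷ []) (_ ∷ _ ∷ _ ∷ _ ∷ []) (_ ∷ _ ∷ _ ∷ _ ∷ []) = zero , zero , zero , refl

⟨⟩-lc : ∀ n c₁ c₂ c₃ v₁ v₂ v₃ →
        ⟨ n , lc c₁ c₂ c₃ v₁ v₂ v₃ ⟩ ≡ ((c₁ *₃ ⟨ n , v₁ ⟩) +₃ (c₂ *₃ ⟨ n , v₂ ⟩)) +₃ (c₃ *₃ ⟨ n , v₃ ⟩)
⟨⟩-lc n c₁ c₂ c₃ v₁ v₂ v₃ = begin
  ⟨ n , lc c₁ c₂ c₃ v₁ v₂ v₃ ⟩
    ≡⟨ ⟨⟩-+ n ((c₁ ·ᵥ v₁) +ᵥ (c₂ ·ᵥ v₂)) (c₃ ·ᵥ v₃) ⟩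
  ⟨ n , (c₁ ·ᵥ v₁) +ᵥ (c₂ ·ᵥ v₂) ⟩ +₃ ⟨ n , c₃ ·ᵥ v₃ ⟩
    ≡⟨ cong₂ _+₃_ (⟨⟩-+ n (c₁ ·ᵥ v₁) (c₂ ·ᵥ v₂)) (⟨⟩-· n c₃ v₃) ⟩
  (⟨ n , c₁ ·ᵥ v₁ ⟩ +₃ ⟨ n , c₂ ·ᵥ v₂ ⟩) +₃ (c₃ *₃ ⟨ n , v₃ ⟩)
    ≡⟨ cong (_+₃ (c₃ *₃ ⟨ n , v₃ ⟩)) (cong₂ _+₃_ (⟨⟩-· n c₁ v₁) (⟨⟩-· n c₂ v₂)) ⟩
  ((c₁ *₃ ⟨ n , v₁ ⟩) +₃ (c₂ *₃ ⟨ n , v₂ ⟩)) +₃ (c₃ *₃ ⟨ n , v₃ ⟩) ∎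
  where open ≡-Reasoning

span⊆kernel : ∀ {n v₁ v₂ v₃ w} → Orthogonal n v₁ v₂ v₃ → InSpan v₁ v₂ v₃ w → ⟨ n , w ⟩ ≡ zero
span⊆kernel {n} {v₁} {v₂} {v₃} (o₁ , o₂ , o₃) (c₁ , c₂ , c₃ , refl)
  rewrite ⟨⟩-lc n c₁ c₂ c₃ v₁ v₂ v₃ | o₁ | o₂ | o₃ | *₃-zeroʳ c₁ | *₃-zeroʳ c₂ | *₃-zeroʳ c₃ = refl

lc-sub : ∀ c₁ c₂ c₃ d₁ d₂ d₃ v₁ v₂ v₃ →
         lc c₁ c₂ c₃ v₁ v₂ v₃ -ᵥ lc d₁ d₂ d₃ v₁ v₂ v₃ ≡ lc (c₁ -₃ d₁) (c₂ -₃ d₂) (c₃ -₃ d₃) v₁ v₂ v₃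
lc-sub c₁ c₂ c₃ d₁ d₂ d₃ (x₁ ∷ x₂ ∷ x₃ ∷ x₄ ∷ []) (y₁ ∷ y₂ ∷ y₃ ∷ y₄ ∷ []) (z₁ ∷ z₂ ∷ z₃ ∷ z₄ ∷ []) =
  cong₂ _∷_ (component x₁ y₁ z₁) (cong₂ _∷_ (component x₂ y₂ z₂)
    (cong₂ _∷_ (component x₃ y₃ z₃) (cong₂ _∷_ (component x₄ y₄ z₄) refl)))
  where
  open ≡-Reasoning
  component : ∀ x y z → (((c₁ *₃ x) +₃ (c₂ *₃ y)) +₃ (c₃ *₃ z)) -₃ (((d₁ *₃ x) +₃ (d₂ *₃ y)) +₃ (d₃ *₃ z))
                      ≡ (((c₁ -₃ d₁) *₃ x) +₃ ((c₂ -₃ d₂) *₃ y)) +₃ ((c₃ -₃ d₃) *₃ z)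
  component x y z = sym (begin
    (((c₁ -₃ d₁) *₃ x) +₃ ((c₂ -₃ d₂) *₃ y)) +₃ ((c₃ -₃ d₃) *₃ z)
      ≡⟨ cong₂ _+₃_ (cong₂ _+₃_ ([x-y]z≡xz-yz c₁ d₁ x) ([x-y]z≡xz-yz c₂ d₂ y)) ([x-y]z≡xz-yz c₃ d₃ z) ⟩
    (((c₁ *₃ x) -₃ (d₁ *₃ x)) +₃ ((c₂ *₃ y) -₃ (d₂ *₃ y))) +₃ ((c₃ *₃ z) -₃ (d₃ *₃ z))
      ≡⟨ cong (_+₃ ((c₃ *₃ z) -₃ (d₃ *₃ z))) (-₃-interchange (c₁ *₃ x) (d₁ *₃ x) (c₂ *₃ y) (d₂ *₃ y)) ⟩
    (((c₁ *₃ x) +₃ (c₂ *₃ y)) -₃ ((d₁ *₃ x) +₃ (d₂ *₃ y))) +₃ ((c₃ *₃ z) -₃ (d₃ *₃ z))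
      ≡⟨ -₃-interchange ((c₁ *₃ x) +₃ (c₂ *₃ y)) ((d₁ *₃ x) +₃ (d₂ *₃ y)) (c₃ *₃ z) (d₃ *₃ z) ⟩
    (((c₁ *₃ x) +₃ (c₂ *₃ y)) +₃ (c₃ *₃ z)) -₃ (((d₁ *₃ x) +₃ (d₂ *₃ y)) +₃ (d₃ *₃ z)) ∎)

lc-injective : ∀ {v₁ v₂ v₃} → LinIndep3 v₁ v₂ v₃ → ∀ {c₁ c₂ c₃ d₁ d₂ d₃} →
               lc c₁ c₂ c₃ v₁ v₂ v₃ ≡ lc d₁ d₂ d₃ v₁ v₂ v₃ → c₁ ≡ d₁ × c₂ ≡ d₂ × c₃ ≡ d₃
lc-injective {v₁} {v₂} {v₃} indep {c₁} {c₂} {c₃} {d₁} {d₂} {d₃} eq =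
  let e₁ , e₂ , e₃ = indep (c₁ -₃ d₁) (c₂ -₃ d₂) (c₃ -₃ d₃) difference≡0
  in x-y≡0⇒x≡y c₁ d₁ e₁ , x-y≡0⇒x≡y c₂ d₂ e₂ , x-y≡0⇒x≡y c₃ d₃ e₃
  where
  difference≡0 : lc (c₁ -₃ d₁) (c₂ -₃ d₂) (c₃ -₃ d₃) v₁ v₂ v₃ ≡ 0ᵥ
  difference≡0 = trans (sym (lc-sub c₁ c₂ c₃ d₁ d₂ d₃ v₁ v₂ v₃))
                       (trans (cong (_-ᵥ lc d₁ d₂ d₃ v₁ v₂ v₃) eq) (x-ᵥx≡0 (lc d₁ d₂ d₃ v₁ v₂ v₃)))

opaque
  ⟨⟩-nondegenerate : ∀ n → n ≢ 0ᵥ → ∃ λ x → ⟨ n , x ⟩ ≢ zero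
  ⟨⟩-nondegenerate = from-yes (∀? λ n → ¬? (n ≟ᵥ 0ᵥ) →-dec ∃? λ x → ¬? (⟨ n , x ⟩ ≟ zero))

normal-exists : ∀ v₁ v₂ v₃ → ∃ λ n → n ≢ 0ᵥ × Orthogonal n v₁ v₂ v₃
normal-exists v₁ v₂ v₃ =
  let a , a′ , a≢a′ , same = pigeonhole (from-yes (3 ^ 3 <? 3 ^ 4)) profile
      same₁ , same₂₃ = Vec.∷-injective same
      same₂ , same₃ = Vec.∷-injective same₂₃
  in a -ᵥ a′ , (λ eq → a≢a′ (x-ᵥy≡0⇒x≡y a a′ eq)) ,
     orthogonal a a′ v₁ same₁ , orthogonal a a′ v₂ same₂ , orthogonal a a′ v₃ (Vec.∷-injectiveˡ same₃)
  where
  profile : F3⁴ → Vec F3 3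
  profile a = ⟨ a , v₁ ⟩ ∷ ⟨ a , v₂ ⟩ ∷ ⟨ a , v₃ ⟩ ∷ []
  orthogonal : ∀ a a′ v → ⟨ a , v ⟩ ≡ ⟨ a′ , v ⟩ → ⟨ a -ᵥ a′ , v ⟩ ≡ zero
  orthogonal a a′ v eq = begin
    ⟨ a -ᵥ a′ , v ⟩          ≡⟨ ⟨⟩-comm (a -ᵥ a′) v ⟩
    ⟨ v , a -ᵥ a′ ⟩          ≡⟨ ⟨⟩--ᵥ v a a′ ⟩
    ⟨ v , a ⟩ -₃ ⟨ v , a′ ⟩   ≡⟨ cong₂ _-₃_ (⟨⟩-comm v a) (⟨⟩-comm v a′) ⟩
    ⟨ a , v ⟩ -₃ ⟨ a′ , v ⟩   ≡⟨ cong (_-₃ ⟨ a′ , v ⟩) eq ⟩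
    ⟨ a′ , v ⟩ -₃ ⟨ a′ , v ⟩  ≡⟨ x-x≡0 ⟨ a′ , v ⟩ ⟩
    zero                     ∎
    where open ≡-Reasoning

-- The span and a vector x off the kernel of n fill F₃⁴ (an injective map from F₃⁴ to itself),
-- and ⟨ n , · ⟩ vanishes on span + t·x only for t = 0.
kernel⊆span : ∀ {n v₁ v₂ v₃} → LinIndep3 v₁ v₂ v₃ → Orthogonal n v₁ v₂ v₃ → n ≢ 0ᵥ →
              ∀ {w} → ⟨ n , w ⟩ ≡ zero → InSpan v₁ v₂ v₃ w
kernel⊆span {n} {v₁} {v₂} {v₃} indep ortho n≢0 {w} nw≡0 =
  from-preimage nw≡0 (injective⇒surjective h h-injective w)
  where
  x = proj₁ (⟨⟩-nondegenerate n n≢0)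
  nx≢0 = proj₂ (⟨⟩-nondegenerate n n≢0)
  h : Vec F3 4 → F3⁴
  h (c₁ ∷ c₂ ∷ c₃ ∷ t ∷ []) = lc c₁ c₂ c₃ v₁ v₂ v₃ +ᵥ (t ·ᵥ x)
  ⟨n,h⟩ : ∀ c₁ c₂ c₃ t → ⟨ n , h (c₁ ∷ c₂ ∷ c₃ ∷ t ∷ []) ⟩ ≡ t *₃ ⟨ n , x ⟩
  ⟨n,h⟩ c₁ c₂ c₃ t = trans (⟨⟩-+ n (lc c₁ c₂ c₃ v₁ v₂ v₃) (t ·ᵥ x))
                           (cong₂ _+₃_ (span⊆kernel {n} {v₁} {v₂} {v₃} ortho (c₁ , c₂ , c₃ , refl)) (⟨⟩-· n t x))
  h-injective : ∀ {c d} → h c ≡ h d → c ≡ d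
  h-injective {c₁ ∷ c₂ ∷ c₃ ∷ t ∷ []} {d₁ ∷ d₂ ∷ d₃ ∷ t′ ∷ []} eq
    with refl ← *₃-cancelʳ t t′ ⟨ n , x ⟩ nx≢0
                  (trans (sym (⟨n,h⟩ c₁ c₂ c₃ t)) (trans (cong ⟨ n ,_⟩ eq) (⟨n,h⟩ d₁ d₂ d₃ t′)))
    with refl , refl , refl ← lc-injective indep {c₁} {c₂} {c₃} {d₁} {d₂} {d₃}
                                (+ᵥ-cancelʳ (lc c₁ c₂ c₃ v₁ v₂ v₃) (lc d₁ d₂ d₃ v₁ v₂ v₃) (t ·ᵥ x) eq)
    = refl
  from-preimage : ∀ {w} → ⟨ n , w ⟩ ≡ zero → (∃ λ c → h c ≡ w) → InSpan v₁ v₂ v₃ w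
  from-preimage nw≡0 (c₁ ∷ c₂ ∷ c₃ ∷ t ∷ [] , refl)
    with refl ← *₃-cancelʳ t zero ⟨ n , x ⟩ nx≢0 (trans (sym (⟨n,h⟩ c₁ c₂ c₃ t)) nw≡0)
    = c₁ , c₂ , c₃ , x+ᵥ0·y≡x (lc c₁ c₂ c₃ v₁ v₂ v₃) x

orthogonal-rescale : ∀ {s m v₁ v₂ v₃} → s ≢ zero → Orthogonal (s ·ᵥ m) v₁ v₂ v₃ → Orthogonal m v₁ v₂ v₃
orthogonal-rescale {s} {m} {v₁} {v₂} {v₃} s≢0 (o₁ , o₂ , o₃) = unscale v₁ o₁ , unscale v₂ o₂ , unscale v₃ o₃
  where
  unscale : ∀ v → ⟨ s ·ᵥ m , v ⟩ ≡ zero → ⟨ m , v ⟩ ≡ zero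
  unscale v smv≡0 = *₃-cancelʳ ⟨ m , v ⟩ zero s s≢0
    (trans (*₃-comm ⟨ m , v ⟩ s) (trans (cong (s *₃_) (⟨⟩-comm m v))
      (trans (sym (⟨⟩-· v s m)) (trans (⟨⟩-comm v (s ·ᵥ m)) smv≡0))))

_≟₈_ : (v w : V8) → Dec (v ≡ w)
_≟₈_ = Vec.≡-dec Bool._≟_

-- point i = ζ_a^i (e₁ + e₈), read in the coordinates (e₁, e₈); code inverts it on nonzero vectors.
point : F3 → V2
point zero             = true ∷ true ∷ []
point (suc zero)       = true ∷ false ∷ []
point (suc (suc zero)) = false ∷ true ∷ []

code : V2 → F3
code (true ∷ true ∷ [])   = zero
code (true ∷ false ∷ [])  = suc zero
code (false ∷ true ∷ [])  = suc (suc zero)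
code (false ∷ false ∷ []) = zero

point-nonzero : ∀ a → Nonzero2 (point a)
point-nonzero zero             = refl
point-nonzero (suc zero)       = refl
point-nonzero (suc (suc zero)) = refl

code-point : ∀ a → code (point a) ≡ a
code-point zero             = refl
code-point (suc zero)       = refl
code-point (suc (suc zero)) = refl

point-code : ∀ p → Nonzero2 p → point (code p) ≡ p
point-code (true ∷ true ∷ [])  _ = refl
point-code (true ∷ false ∷ []) _ = refl
point-code (false ∷ true ∷ []) _ = refl

assemble : ∀ {X : Set} → Vec X 2 → Vec X 2 → Vec X 2 → Vec X 2 → Vec X 8
assemble (a₁ ∷ a₂ ∷ []) (b₁ ∷ b₂ ∷ []) (c₁ ∷ c₂ ∷ []) (d₁ ∷ d₂ ∷ []) =
  a₁ ∷ b₁ ∷ c₁ ∷ d₁ ∷ d₂ ∷ c₂ ∷ b₂ ∷ a₂ ∷ []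

assemble-cong : ∀ {X : Set} {a a′ b b′ c c′ d d′ : Vec X 2} →
                a ≡ a′ → b ≡ b′ → c ≡ c′ → d ≡ d′ → assemble a b c d ≡ assemble a′ b′ c′ d′
assemble-cong refl refl refl refl = refl

-- ζ_b and ζ_d rotate their planes the other way round, hence the signs.
orbitPoint : F3⁴ → V8
orbitPoint (a ∷ b ∷ c ∷ d ∷ []) = assemble (point a) (point (-1₃ *₃ b)) (point c) (point (-1₃ *₃ d))

decode : V8 → F3⁴
decode (x₁ ∷ x₂ ∷ x₃ ∷ x₄ ∷ x₅ ∷ x₆ ∷ x₇ ∷ x₈ ∷ []) =
  code (x₁ ∷ x₈ ∷ []) ∷ -1₃ *₃ code (x₂ ∷ x₇ ∷ []) ∷ code (x₃ ∷ x₆ ∷ []) ∷ -1₃ *₃ code (x₄ ∷ x₅ ∷ []) ∷ []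

inΩ4? : ∀ v → Dec (InΩ4 v)
inΩ4? (_ ∷ _ ∷ _ ∷ _ ∷ _ ∷ _ ∷ _ ∷ _ ∷ []) = _ Bool.≟ true

opaque
  A-orbitPoint : ∀ l → A l u ≡ orbitPoint l
  A-orbitPoint = from-yes (∀? λ l → A l u ≟₈ orbitPoint l)

  decode-A : ∀ l → decode (A l u) ≡ l
  decode-A = from-yes (∀? λ l → decode (A l u) ≟ᵥ l)

  A-in-ω4 : ∀ l → InΩ4 (A l u)
  A-in-ω4 = from-yes (∀? λ l → inΩ4? (A l u))

A-injective : ∀ {l l′} → A l u ≡ A l′ u → l ≡ l′
A-injective {l} {l′} eq = trans (sym (decode-A l)) (trans (cong decode eq) (decode-A l′))

Plane : F3⁴ → F3 → PointSet
Plane n β p = ∃ λ l → ⟨ n , l ⟩ ≡ β × p ≡ A l u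

Plane-member : ∀ n β l → Plane n β (A l u) → ⟨ n , l ⟩ ≡ β
Plane-member n β _ (l′ , nl′≡β , eq) = subst (λ l → ⟨ n , l ⟩ ≡ β) (sym (A-injective eq)) nl′≡β

coset-is-plane : ∀ {n v₁ v₂ v₃} → LinIndep3 v₁ v₂ v₃ → Orthogonal n v₁ v₂ v₃ → n ≢ 0ᵥ →
                 ∀ μ → SameSet (CosetSet v₁ v₂ v₃ μ) (Plane n ⟨ n , μ ⟩)
coset-is-plane {n} {v₁} {v₂} {v₃} indep ortho n≢0 μ p = mk⇔ to from
  where
  to : CosetSet v₁ v₂ v₃ μ p → Plane n ⟨ n , μ ⟩ p
  to (w , w∈span , p≡) = μ +ᵥ w ,
    trans (⟨⟩-+ n μ w) (trans (cong (⟨ n , μ ⟩ +₃_) (span⊆kernel {n} ortho w∈span)) (+₃-identityʳ _)) , p≡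
  from : Plane n ⟨ n , μ ⟩ p → CosetSet v₁ v₂ v₃ μ p
  from (l , nl≡nμ , p≡) = l -ᵥ μ ,
    kernel⊆span indep ortho n≢0 (trans (⟨⟩--ᵥ n l μ) (trans (cong (_-₃ ⟨ n , μ ⟩) nl≡nμ) (x-x≡0 ⟨ n , μ ⟩))) ,
    trans p≡ (cong (λ l → A l u) (sym (x+ᵥ[y-ᵥx]≡y μ l)))

SameSet-sym : ∀ {S T} → SameSet S T → SameSet T S
SameSet-sym S≃T p = ⇔.sym (S≃T p)

SameSet-trans : ∀ {S T R} → SameSet S T → SameSet T R → SameSet S R
SameSet-trans S≃T T≃R p = ⇔.trans (S≃T p) (T≃R p)

IsSegre-resp : ∀ {S T} → SameSet S T → IsSegre T → IsSegre S
IsSegre-resp S≃T (M , invertible , T≃M) = M , invertible , SameSet-trans S≃T T≃M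

Sign : Set
Sign = Fin 2

±1 : Sign → F3
±1 zero       = 1₃
±1 (suc zero) = -1₃

-- The planes of kind P₀ have normals with no zero entry, normalised to start with 1.
normal : Vec Sign 3 → F3⁴
normal (s₂ ∷ s₃ ∷ s₄ ∷ []) = 1₃ ∷ ±1 s₂ ∷ ±1 s₃ ∷ ±1 s₄ ∷ []

normal≢0 : ∀ σ → normal σ ≢ 0ᵥ
normal≢0 (_ ∷ _ ∷ _ ∷ []) ()

P0Plane : Set
P0Plane = Vec Sign 3 × F3

planeSet : P0Plane → PointSet
planeSet (σ , β) = Plane (normal σ) β

opaque
  normal-avoids-units : ∀ σ → let m = normal σ ; m0 = ⟨ m , 0ᵥ ⟩ in
    ⟨ m , p1000 ⟩ ≢ m0 × ⟨ m , p0100 ⟩ ≢ m0 × ⟨ m , p0010 ⟩ ≢ m0 × ⟨ m , p0001 ⟩ ≢ m0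
  normal-avoids-units = from-yes (∀? λ σ → let m = normal σ ; m0 = ⟨ m , 0ᵥ ⟩ in
    ¬? (⟨ m , p1000 ⟩ ≟ m0) ×-dec ¬? (⟨ m , p0100 ⟩ ≟ m0) ×-dec ¬? (⟨ m , p0010 ⟩ ≟ m0) ×-dec ¬? (⟨ m , p0001 ⟩ ≟ m0))

  nonzero-entries⇒normal : ∀ n → ⟨ n , p1000 ⟩ ≢ zero → ⟨ n , p0100 ⟩ ≢ zero → ⟨ n , p0010 ⟩ ≢ zero →
                           ⟨ n , p0001 ⟩ ≢ zero → ∃ λ ((σ , s) : Vec Sign 3 × F3) → s ≢ zero × n ≡ s ·ᵥ normal σ
  nonzero-entries⇒normal = from-yes (∀? λ n → ¬? (⟨ n , p1000 ⟩ ≟ zero) →-dec ¬? (⟨ n , p0100 ⟩ ≟ zero) →-dec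
    ¬? (⟨ n , p0010 ⟩ ≟ zero) →-dec ¬? (⟨ n , p0001 ⟩ ≟ zero) →-dec
    ∃? λ ((σ , s) : Vec Sign 3 × F3) → ¬? (s ≟ zero) ×-dec (n ≟ᵥ (s ·ᵥ normal σ)))

  P0-planes-separated : ∀ P P′ → P ≢ P′ →
                        ∃ λ l → ⟨ normal (proj₁ P) , l ⟩ ≡ proj₂ P × ⟨ normal (proj₁ P′) , l ⟩ ≢ proj₂ P′
  P0-planes-separated = from-yes (∀? λ P → ∀? λ P′ → ¬? (Product.≡-dec (Vec.≡-dec _≟_) _≟_ P P′) →-dec
    ∃? λ l → (⟨ normal (proj₁ P) , l ⟩ ≟ proj₂ P) ×-dec ¬? (⟨ normal (proj₁ P′) , l ⟩ ≟ proj₂ P′))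

P0-plane⊆ω4 : ∀ P → planeSet P ⊆ InΩ4
P0-plane⊆ω4 P _ (l , _ , refl) = A-in-ω4 l

P0-planes-distinct : ∀ P P′ → P ≢ P′ → ¬ SameSet (planeSet P) (planeSet P′)
P0-planes-distinct P P′ P≢P′ same =
  let l , on-P , off-P′ = P0-planes-separated P P′ P≢P′
  in off-P′ (Plane-member (normal (proj₁ P′)) (proj₂ P′) l (Equivalence.to (same (A l u)) (l , on-P , refl)))

-- The block (α , s) maps x ⊗ y ⊗ z to point (α ± code x ± code y ± code z).
Block : Set
Block = F3 × Vec Sign 3

blockValue : Block → F3 → F3 → F3 → F3
blockValue (α , s₁ ∷ s₂ ∷ s₃ ∷ []) c₁ c₂ c₃ = α +₃ (((c₁ *₃ ±1 s₁) +₃ (c₂ *₃ ±1 s₂)) +₃ (c₃ *₃ ±1 s₃))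

second : V2 → Bool
second (_ ∷ b ∷ []) = b

onBasis : ∀ {X : Set} → (V2 → V2 → V2 → X) → Vec X 8
onBasis f = f e₁ e₁ e₁ ∷ f e₁ e₁ e₂ ∷ f e₁ e₂ e₁ ∷ f e₁ e₂ e₂ ∷ f e₂ e₁ e₁ ∷ f e₂ e₁ e₂ ∷ f e₂ e₂ e₁ ∷ f e₂ e₂ e₂ ∷ []
  where
  e₁ e₂ : V2
  e₁ = true ∷ false ∷ []
  e₂ = false ∷ true ∷ []

onBasis-cong : ∀ {X : Set} {f g : V2 → V2 → V2 → X} →
               (∀ x y z → Nonzero2 x → Nonzero2 y → Nonzero2 z → f x y z ≡ g x y z) → onBasis f ≡ onBasis g
onBasis-cong f≗g =
  cong₂ _∷_ (f≗g _ _ _ refl refl refl) (cong₂ _∷_ (f≗g _ _ _ refl refl refl)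
  (cong₂ _∷_ (f≗g _ _ _ refl refl refl) (cong₂ _∷_ (f≗g _ _ _ refl refl refl)
  (cong₂ _∷_ (f≗g _ _ _ refl refl refl) (cong₂ _∷_ (f≗g _ _ _ refl refl refl)
  (cong₂ _∷_ (f≗g _ _ _ refl refl refl) (cong₂ _∷_ (f≗g _ _ _ refl refl refl) refl)))))))

rowsOf : Vec F3 8 → Vec V8 2
rowsOf ks = map (head ∘ point) ks ∷ map (second ∘ point) ks ∷ []

blockCodes : Block → Vec F3 8
blockCodes B = onBasis (λ x y z → blockValue B (code x) (code y) (code z))

blockRows : Block → Vec V8 2
blockRows B = rowsOf (blockCodes B)

rowValues : Vec V8 k → V8 → Vec Bool k
rowValues R v = map (λ r → dot r v) R

Nonvanishing : Vec V8 2 → Set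
Nonvanishing R = ∀ x y z → Nonzero2 x → Nonzero2 y → Nonzero2 z → Nonzero2 (rowValues R (tensor x y z))

nonzero? : ∀ p → Dec (Nonzero2 p)
nonzero? (a ∷ b ∷ []) = (a ∨ b) Bool.≟ true

nonvanishing? : ∀ R → Dec (Nonvanishing R)
nonvanishing? R = ∀? λ x → ∀? λ y → ∀? λ z →
  nonzero? x →-dec (nonzero? y →-dec (nonzero? z →-dec nonzero? (rowValues R (tensor x y z))))

opaque
  onBasis-dot : ∀ r → onBasis (λ x y z → dot r (tensor x y z)) ≡ r
  onBasis-dot = from-yes (∀? λ r → onBasis (λ x y z → dot r (tensor x y z)) ≟₈ r)

  nonvanishing-codes : ∀ ks → Nonvanishing (rowsOf ks) → ∃ λ B → ks ≡ blockCodes B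
  nonvanishing-codes = from-yes (∀? λ ks → nonvanishing? (rowsOf ks) →-dec ∃? λ B → Vec.≡-dec _≟_ ks (blockCodes B))

  blockRows-values : ∀ B x y z → Nonzero2 x → Nonzero2 y → Nonzero2 z →
                     rowValues (blockRows B) (tensor x y z) ≡ point (blockValue B (code x) (code y) (code z))
  blockRows-values = from-yes (∀? λ B → ∀? λ x → ∀? λ y → ∀? λ z → nonzero? x →-dec (nonzero? y →-dec (nonzero? z →-dec
    Vec.≡-dec Bool._≟_ (rowValues (blockRows B) (tensor x y z)) (point (blockValue B (code x) (code y) (code z))))))

-- A pair of rows is determined by its values on the basis tensors, which are nonzero there.
nonvanishing-block : ∀ R → Nonvanishing R → ∃ λ B → R ≡ blockRows B
nonvanishing-block R@(r ∷ r′ ∷ []) nonvanishing =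
  let B , ks≡ = nonvanishing-codes ks (subst Nonvanishing R≡rowsOf-ks nonvanishing)
  in B , trans R≡rowsOf-ks (cong rowsOf ks≡)
  where
  pair : V2 → V2 → V2 → V2
  pair x y z = rowValues R (tensor x y z)
  ks : Vec F3 8
  ks = onBasis (λ x y z → code (pair x y z))
  column : ∀ x y z → Nonzero2 x → Nonzero2 y → Nonzero2 z → pair x y z ≡ point (code (pair x y z))
  column x y z nx ny nz = sym (point-code _ (nonvanishing x y z nx ny nz))
  R≡rowsOf-ks : R ≡ rowsOf ks
  R≡rowsOf-ks = cong₂ (λ r r′ → r ∷ r′ ∷ [])
    (trans (sym (onBasis-dot r))
      (onBasis-cong {f = λ x y z → head (pair x y z)} {g = λ x y z → head (point (code (pair x y z)))}
                    λ x y z nx ny nz → cong head (column x y z nx ny nz)))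
    (trans (sym (onBasis-dot r′))
      (onBasis-cong {f = λ x y z → second (pair x y z)} {g = λ x y z → second (point (code (pair x y z)))}
                    λ x y z nx ny nz → cong second (column x y z nx ny nz)))

Quad : Set
Quad = Vec Block 4

quadMatrix : Quad → Mat
quadMatrix (Ba ∷ Bb ∷ Bc ∷ Bd ∷ []) = assemble (blockRows Ba) (blockRows Bb) (blockRows Bc) (blockRows Bd)

quadPoint : Quad → F3 → F3 → F3 → F3⁴
quadPoint (Ba ∷ Bb ∷ Bc ∷ Bd ∷ []) c₁ c₂ c₃ =
  blockValue Ba c₁ c₂ c₃ ∷ -1₃ *₃ blockValue Bb c₁ c₂ c₃ ∷ blockValue Bc c₁ c₂ c₃ ∷ -1₃ *₃ blockValue Bd c₁ c₂ c₃ ∷ []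

signPattern : Quad → Vec (Vec Sign 3) 4
signPattern = map proj₂

offset : Quad → F3⁴
offset ((α , _) ∷ (β , _) ∷ (γ , _) ∷ (δ , _) ∷ []) = α ∷ -1₃ *₃ β ∷ γ ∷ -1₃ *₃ δ ∷ []

column : Vec (Vec Sign 3) 4 → Fin 3 → F3⁴
column (sa ∷ sb ∷ sc ∷ sd ∷ []) j =
  ±1 (lookup sa j) ∷ -1₃ *₃ ±1 (lookup sb j) ∷ ±1 (lookup sc j) ∷ -1₃ *₃ ±1 (lookup sd j) ∷ []

quadCoset : Quad → PointSet
quadCoset Q = let S = signPattern Q in CosetSet (column S (# 0)) (column S (# 1)) (column S (# 2)) (offset Q)

apply-quadMatrix : ∀ Q x y z → Nonzero2 x → Nonzero2 y → Nonzero2 z →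
                   apply (quadMatrix Q) (tensor x y z) ≡ A (quadPoint Q (code x) (code y) (code z)) u
apply-quadMatrix Q@(Ba ∷ Bb ∷ Bc ∷ Bd ∷ []) x y z nx ny nz =
  trans (assemble-cong (values Ba) (flipped Bb) (values Bc) (flipped Bd))
        (sym (A-orbitPoint (quadPoint Q (code x) (code y) (code z))))
  where
  values : ∀ B → rowValues (blockRows B) (tensor x y z) ≡ point (blockValue B (code x) (code y) (code z))
  values B = blockRows-values B x y z nx ny nz
  flipped : ∀ B → rowValues (blockRows B) (tensor x y z) ≡ point (-1₃ *₃ (-1₃ *₃ blockValue B (code x) (code y) (code z)))
  flipped B = trans (values B) (cong point (sym (-1₃-involutive _)))

quadPoint-affine : ∀ Q c₁ c₂ c₃ → let S = signPattern Q in
                   quadPoint Q c₁ c₂ c₃ ≡ offset Q +ᵥ lc c₁ c₂ c₃ (column S (# 0)) (column S (# 1)) (column S (# 2))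
quadPoint-affine ((_ , _ ∷ _ ∷ _ ∷ []) ∷ (β , b₁ ∷ b₂ ∷ b₃ ∷ []) ∷ (_ , _ ∷ _ ∷ _ ∷ []) ∷ (δ , d₁ ∷ d₂ ∷ d₃ ∷ []) ∷ []) c₁ c₂ c₃ =
  cong₂ _∷_ refl (cong₂ _∷_ (-1₃-affine β (±1 b₁) (±1 b₂) (±1 b₃) c₁ c₂ c₃)
    (cong₂ _∷_ refl (cong₂ _∷_ (-1₃-affine δ (±1 d₁) (±1 d₂) (±1 d₃) c₁ c₂ c₃) refl)))

segreImage-quad : ∀ Q → SameSet (SegreImage (quadMatrix Q)) (quadCoset Q)
segreImage-quad Q p = mk⇔ to from
  where
  to : SegreImage (quadMatrix Q) p → quadCoset Q p
  to (x , y , z , nx , ny , nz , p≡) = _ , (code x , code y , code z , refl) ,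
    trans p≡ (trans (apply-quadMatrix Q x y z nx ny nz) (cong (λ l → A l u) (quadPoint-affine Q (code x) (code y) (code z))))
  from : quadCoset Q p → SegreImage (quadMatrix Q) p
  from (_ , (c₁ , c₂ , c₃ , refl) , p≡) =
    point c₁ , point c₂ , point c₃ , point-nonzero c₁ , point-nonzero c₂ , point-nonzero c₃ ,
    trans p≡ (sym (trans (apply-quadMatrix Q (point c₁) (point c₂) (point c₃) (point-nonzero c₁) (point-nonzero c₂) (point-nonzero c₃))
      (cong (λ l → A l u) (trans (cong₂ (λ a (b , c) → quadPoint Q a b c) (code-point c₁) (cong₂ _,_ (code-point c₂) (code-point c₃)))
                                 (quadPoint-affine Q c₁ c₂ c₃)))))

quad-plane : ∀ Q σ → let S = signPattern Q ; v₁ = column S (# 0) ; v₂ = column S (# 1) ; v₃ = column S (# 2) in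
             Orthogonal (normal σ) v₁ v₂ v₃ → LinIndep3 v₁ v₂ v₃ →
             SameSet (SegreImage (quadMatrix Q)) (planeSet (σ , ⟨ normal σ , offset Q ⟩))
quad-plane Q σ ortho indep = SameSet-trans (segreImage-quad Q) (coset-is-plane indep ortho (normal≢0 σ) (offset Q))

Proportional : Vec Sign 3 → Vec Sign 3 → Set
Proportional s s′ = s ≡ s′ ⊎ s ≡ map opposite s′

proportional? : ∀ s s′ → Dec (Proportional s s′)
proportional? s s′ = Vec.≡-dec _≟_ s s′ ⊎-dec Vec.≡-dec _≟_ s (map opposite s′)

Degenerate : Vec (Vec Sign 3) 4 → Set
Degenerate S = ∃ λ ((X , Y) : Fin 4 × Fin 4) → X ≢ Y × Proportional (lookup S X) (lookup S Y)

degenerate? : ∀ S → Dec (Degenerate S)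
degenerate? S = ∃? λ ((X , Y) : Fin 4 × Fin 4) → ¬? (X ≟ Y) ×-dec proportional? (lookup S X) (lookup S Y)

rowIndices : Fin 4 → Vec (Fin 8) 2
rowIndices zero                   = # 0 ∷ # 7 ∷ []
rowIndices (suc zero)             = # 1 ∷ # 6 ∷ []
rowIndices (suc (suc zero))       = # 2 ∷ # 5 ∷ []
rowIndices (suc (suc (suc zero))) = # 3 ∷ # 4 ∷ []

placeAt : Vec (Fin 8) 4 → Vec Bool 4 → V8
placeAt (i₁ ∷ i₂ ∷ i₃ ∷ i₄ ∷ []) (t₁ ∷ t₂ ∷ t₃ ∷ t₄ ∷ []) = replicate 8 false [ i₁ ]≔ t₁ [ i₂ ]≔ t₂ [ i₃ ]≔ t₃ [ i₄ ]≔ t₄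

quadMatrix-rows : ∀ Q X → map (lookup (quadMatrix Q)) (rowIndices X) ≡ blockRows (lookup Q X)
quadMatrix-rows (_ ∷ _ ∷ _ ∷ _ ∷ []) zero                   = refl
quadMatrix-rows (_ ∷ _ ∷ _ ∷ _ ∷ []) (suc zero)             = refl
quadMatrix-rows (_ ∷ _ ∷ _ ∷ _ ∷ []) (suc (suc zero))       = refl
quadMatrix-rows (_ ∷ _ ∷ _ ∷ _ ∷ []) (suc (suc (suc zero))) = refl

lookup-apply : ∀ M v (is : Vec (Fin 8) k) → map (lookup (apply M v)) is ≡ rowValues (map (lookup M) is) v
lookup-apply M v is = trans (Vec.map-cong (λ i → Vec.lookup-map i (λ r → dot r v) M) is)
                            (Vec.map-∘ (λ r → dot r v) (lookup M) is)

opaque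
  placeAt-rowIndices : ∀ X Y → X ≢ Y → ∀ t → let is = rowIndices X ++ rowIndices Y in map (lookup (placeAt is t)) is ≡ t
  placeAt-rowIndices = from-yes (∀? λ X → ∀? λ Y → ¬? (X ≟ Y) →-dec ∀? λ t →
    let is = rowIndices X ++ rowIndices Y in Vec.≡-dec Bool._≟_ (map (lookup (placeAt is t)) is) t)

  proportional-blocks-dependent : ∀ B B′ → Proportional (proj₂ B) (proj₂ B′) →
                                  ∃ λ t → ∀ v → rowValues (blockRows B ++ blockRows B′) v ≢ t
  proportional-blocks-dependent = from-yes (∀? λ B → ∀? λ B′ → proportional? (proj₂ B) (proj₂ B′) →-dec
    ∃? λ t → ∀? λ v → ¬? (Vec.≡-dec Bool._≟_ (rowValues (blockRows B ++ blockRows B′) v) t))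

  nondegenerate⇒normal : ∀ S → ¬ Degenerate S → let v₁ = column S (# 0) ; v₂ = column S (# 1) ; v₃ = column S (# 2) in
                         ∃ λ σ → Orthogonal (normal σ) v₁ v₂ v₃ × LinIndep3 v₁ v₂ v₃
  nondegenerate⇒normal = from-yes (∀? λ S → ¬? (degenerate? S) →-dec
    let v₁ = column S (# 0) ; v₂ = column S (# 1) ; v₃ = column S (# 2)
    in ∃? λ σ → orthogonal? (normal σ) v₁ v₂ v₃ ×-dec linIndep3? v₁ v₂ v₃)

-- An invertible matrix attains every vector, but the four rows of two proportional blocks miss a pattern t.
degenerate⇒singular : ∀ Q → Degenerate (signPattern Q) → ¬ Invertible (quadMatrix Q)
degenerate⇒singular Q ((X , Y) , X≢Y , proportional) (N , _ , M∘N≡id) =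
  let t , missed = proportional-blocks-dependent (lookup Q X) (lookup Q Y)
                     (subst₂ Proportional (Vec.lookup-map X proj₂ Q) (Vec.lookup-map Y proj₂ Q) proportional)
      w = placeAt is t
      v = apply N w
  in missed v (begin
    rowValues (blockRows (lookup Q X) ++ blockRows (lookup Q Y)) v ≡⟨ cong (λ R → rowValues R v) (sym rows) ⟩
    rowValues (map (lookup M) is) v                                 ≡⟨ sym (lookup-apply M v is) ⟩
    map (lookup (apply M v)) is                                     ≡⟨ cong (λ w → map (lookup w) is) (M∘N≡id w) ⟩
    map (lookup w) is                                               ≡⟨ placeAt-rowIndices X Y X≢Y t ⟩
    t                                                               ∎)
  where
  open ≡-Reasoning
  M = quadMatrix Q
  is = rowIndices X ++ rowIndices Y
  rows : map (lookup M) is ≡ blockRows (lookup Q X) ++ blockRows (lookup Q Y)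
  rows = trans (Vec.map-++ (lookup M) (rowIndices X) (rowIndices Y))
               (cong₂ _++_ (quadMatrix-rows Q X) (quadMatrix-rows Q Y))

ω4-blocks : ∀ pa pb pc pd → InΩ4 (assemble pa pb pc pd) → Nonzero2 pa × Nonzero2 pb × Nonzero2 pc × Nonzero2 pd
ω4-blocks (a ∷ a′ ∷ []) (b ∷ b′ ∷ []) (c ∷ c′ ∷ []) (d ∷ d′ ∷ []) in-ω4 =
  let bcd = Bool.∧-conicalʳ (a ∨ a′) _ in-ω4
      cd  = Bool.∧-conicalʳ (b ∨ b′) _ bcd
  in Bool.∧-conicalˡ _ _ in-ω4 , Bool.∧-conicalˡ _ _ bcd , Bool.∧-conicalˡ _ _ cd , Bool.∧-conicalʳ (c ∨ c′) _ cd

segre⊆ω4⇒P0-plane : ∀ S → IsSegre S → S ⊆ InΩ4 → ∃ λ P → SameSet S (planeSet P)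
segre⊆ω4⇒P0-plane S (M@(r₁ ∷ r₂ ∷ r₃ ∷ r₄ ∷ r₅ ∷ r₆ ∷ r₇ ∷ r₈ ∷ []) , invertible , S≃M) S⊆ω4 =
  classify Q (subst Invertible M≡Q invertible) (subst (λ M → SameSet S (SegreImage M)) M≡Q S≃M)
  where
  blocks : ∀ x y z → Nonzero2 x → Nonzero2 y → Nonzero2 z → let t = tensor x y z in
           Nonzero2 (rowValues (r₁ ∷ r₈ ∷ []) t) × Nonzero2 (rowValues (r₂ ∷ r₇ ∷ []) t) ×
           Nonzero2 (rowValues (r₃ ∷ r₆ ∷ []) t) × Nonzero2 (rowValues (r₄ ∷ r₅ ∷ []) t)
  blocks x y z nx ny nz = let t = tensor x y z in
    ω4-blocks (rowValues (r₁ ∷ r₈ ∷ []) t) (rowValues (r₂ ∷ r₇ ∷ []) t) (rowValues (r₃ ∷ r₆ ∷ []) t) (rowValues (r₄ ∷ r₅ ∷ []) t)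
              (S⊆ω4 (apply M t) (Equivalence.from (S≃M _) (x , y , z , nx , ny , nz , refl)))
  Ba = nonvanishing-block (r₁ ∷ r₈ ∷ []) λ x y z nx ny nz → proj₁ (blocks x y z nx ny nz)
  Bb = nonvanishing-block (r₂ ∷ r₇ ∷ []) λ x y z nx ny nz → proj₁ (proj₂ (blocks x y z nx ny nz))
  Bc = nonvanishing-block (r₃ ∷ r₆ ∷ []) λ x y z nx ny nz → proj₁ (proj₂ (proj₂ (blocks x y z nx ny nz)))
  Bd = nonvanishing-block (r₄ ∷ r₅ ∷ []) λ x y z nx ny nz → proj₂ (proj₂ (proj₂ (blocks x y z nx ny nz)))
  Q : Quad
  Q = proj₁ Ba ∷ proj₁ Bb ∷ proj₁ Bc ∷ proj₁ Bd ∷ []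
  M≡Q : M ≡ quadMatrix Q
  M≡Q = assemble-cong (proj₂ Ba) (proj₂ Bb) (proj₂ Bc) (proj₂ Bd)
  classify : ∀ Q → Invertible (quadMatrix Q) → SameSet S (SegreImage (quadMatrix Q)) → ∃ λ P → SameSet S (planeSet P)
  classify Q invertible S≃Q with degenerate? (signPattern Q)
  ... | yes degenerate = ⊥-elim (degenerate⇒singular Q degenerate invertible)
  ... | no nondegenerate =
    let σ , ortho , indep = nondegenerate⇒normal (signPattern Q) nondegenerate
    in (σ , ⟨ normal σ , offset Q ⟩) , SameSet-trans S≃Q (quad-plane Q σ ortho indep)

scaleSigns : Sign → Vec Sign 3 → Vec Sign 3
scaleSigns zero       s = s
scaleSigns (suc zero) s = map opposite s

-- With u₁ = (+++), u₂ = (+--), u₃ = (++-), u₄ = (+-+) one has u₁ + u₂ = u₃ + u₄,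
-- which makes the normal (1, n₂, n₃, n₄) orthogonal to all three columns.
planeQuad : P0Plane → Quad
planeQuad (s₂ ∷ s₃ ∷ s₄ ∷ [] , β) =
  (β , + ∷ + ∷ + ∷ []) ∷ (zero , scaleSigns (opposite s₂) (+ ∷ - ∷ - ∷ [])) ∷
  (zero , scaleSigns (opposite s₃) (+ ∷ + ∷ - ∷ [])) ∷ (zero , scaleSigns s₄ (+ ∷ - ∷ + ∷ [])) ∷ []
  where
  + - : Sign
  + = zero
  - = suc zero

Inverse : Mat → Mat → Set
Inverse M N = (∀ v → apply N (apply M v) ≡ v) × (∀ v → apply M (apply N v) ≡ v)

-- The columns of the inverse are the preimages of the unit vectors, found by search.
inverseBySearch : Mat → Mat
inverseBySearch M = transpose (map preimage (tabulate λ i → replicate 8 false [ i ]≔ true))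
  where
  preimage : V8 → V8
  preimage w = fromMaybe w (find (λ v → apply M v ≟₈ w) elements)

inverse? : ∀ M N → Dec (Inverse M N)
inverse? M N = ∀? (λ v → apply N (apply M v) ≟₈ v) ×-dec ∀? (λ v → apply M (apply N v) ≟₈ v)

inverseBySearch? : ∀ M → Dec (Inverse M (inverseBySearch M))
inverseBySearch? M = inverse? M (inverseBySearch M)

opaque
  planeQuad-normal : ∀ P → let σ = proj₁ P ; S = signPattern (planeQuad P) in
    Orthogonal (normal σ) (column S (# 0)) (column S (# 1)) (column S (# 2)) ×
    LinIndep3 (column S (# 0)) (column S (# 1)) (column S (# 2)) × ⟨ normal σ , offset (planeQuad P) ⟩ ≡ proj₂ P
  planeQuad-normal = from-yes (∀? λ P → let σ = proj₁ P ; S = signPattern (planeQuad P) in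
    orthogonal? (normal σ) (column S (# 0)) (column S (# 1)) (column S (# 2)) ×-dec
    linIndep3? (column S (# 0)) (column S (# 1)) (column S (# 2)) ×-dec (⟨ normal σ , offset (planeQuad P) ⟩ ≟ proj₂ P))

  planeQuad-invertible : ∀ P → Inverse (quadMatrix (planeQuad P)) (inverseBySearch (quadMatrix (planeQuad P)))
  planeQuad-invertible = from-yes (∀? λ P → inverseBySearch? (quadMatrix (planeQuad P)))

P0-plane-segre : ∀ P → IsSegre (planeSet P)
P0-plane-segre P@(σ , β) =
  let ortho , indep , nα≡β = planeQuad-normal P
      M = quadMatrix (planeQuad P)
  in M , (inverseBySearch M , planeQuad-invertible P) ,
     SameSet-sym (subst (λ β → SameSet (SegreImage M) (planeSet (σ , β))) nα≡β (quad-plane (planeQuad P) σ ortho indep))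

plane : Fin 24 → P0Plane
plane i = fromFin {2} 3 (proj₁ (remQuot {2 ^ 3} 3 i)) , proj₂ (remQuot {2 ^ 3} 3 i)

plane-injective : ∀ {i j} → plane i ≡ plane j → i ≡ j
plane-injective {i} {j} eq = begin
  i                                ≡⟨ sym (combine-remQuot {2 ^ 3} 3 i) ⟩
  combine (proj₁ qr) (proj₂ qr)    ≡⟨ cong₂ combine (fromFin-injective {2} 3 {proj₁ qr} {proj₁ qr′} (cong proj₁ eq)) (cong proj₂ eq) ⟩
  combine (proj₁ qr′) (proj₂ qr′)  ≡⟨ combine-remQuot {2 ^ 3} 3 j ⟩
  j                                ∎
  where
  open ≡-Reasoning
  qr qr′ : Fin (2 ^ 3) × Fin 3
  qr = remQuot {2 ^ 3} 3 i
  qr′ = remQuot {2 ^ 3} 3 j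

plane-surjective : ∀ P → ∃ λ i → plane i ≡ P
plane-surjective (σ , β) =
  combine (toFin σ) β ,
  trans (cong (λ (q , r) → fromFin 3 q , r) (remQuot-combine (toFin σ) β)) (cong (_, β) (fromFin-toFin σ))

exactly24 : Exactly24SegreInΩ4
exactly24 =
  (λ i → planeSet (plane i)) ,
  (λ i → P0-plane-segre (plane i) , P0-plane⊆ω4 (plane i)) ,
  (λ i j i≢j → P0-planes-distinct (plane i) (plane j) (λ eq → i≢j (plane-injective eq))) ,
  λ S segre S⊆ω4 →
    let P , S≃P = segre⊆ω4⇒P0-plane S segre S⊆ω4
        i , plane-i≡P = plane-surjective P
    in i , subst (λ P → SameSet S (planeSet P)) (sym plane-i≡P) S≃P

segre-cosets⇒P0 : ∀ v₁ v₂ v₃ → (∀ μ → IsSegre (CosetSet v₁ v₂ v₃ μ)) → KindP0 v₁ v₂ v₃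
segre-cosets⇒P0 v₁ v₂ v₃ segre =
  let (σ , β) , V₃≃P = segre⊆ω4⇒P0-plane V₃ (segre 0ᵥ) V₃⊆ω4
      on-plane : ∀ {w} → InSpan v₁ v₂ v₃ w → ⟨ normal σ , 0ᵥ +ᵥ w ⟩ ≡ β
      on-plane {w} w∈span = Plane-member (normal σ) β (0ᵥ +ᵥ w) (Equivalence.to (V₃≃P _) (w , w∈span , refl))
      β≡ = on-plane (0∈span v₁ v₂ v₃)
      off₁ , off₂ , off₃ , off₄ = normal-avoids-units σ
  in (λ e∈span → off₁ (trans (on-plane e∈span) (sym β≡))) , (λ e∈span → off₂ (trans (on-plane e∈span) (sym β≡))) ,
     (λ e∈span → off₃ (trans (on-plane e∈span) (sym β≡))) , (λ e∈span → off₄ (trans (on-plane e∈span) (sym β≡)))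
  where
  V₃ = CosetSet v₁ v₂ v₃ 0ᵥ
  V₃⊆ω4 : V₃ ⊆ InΩ4
  V₃⊆ω4 _ (w , _ , refl) = A-in-ω4 (0ᵥ +ᵥ w)

P0⇒segre-cosets : ∀ {v₁ v₂ v₃} → LinIndep3 v₁ v₂ v₃ → KindP0 v₁ v₂ v₃ → ∀ μ → IsSegre (CosetSet v₁ v₂ v₃ μ)
P0⇒segre-cosets {v₁} {v₂} {v₃} indep (∉₁ , ∉₂ , ∉₃ , ∉₄) μ =
  let n , n≢0 , ortho = normal-exists v₁ v₂ v₃
      off : ∀ {e} → ¬ InSpan v₁ v₂ v₃ e → ⟨ n , e ⟩ ≢ zero
      off e∉span ne≡0 = e∉span (kernel⊆span indep ortho n≢0 ne≡0)
      (σ , s) , s≢0 , n≡sm = nonzero-entries⇒normal n (off ∉₁) (off ∉₂) (off ∉₃) (off ∉₄)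
      ortho′ = orthogonal-rescale {s} {normal σ} s≢0 (subst (λ n → Orthogonal n v₁ v₂ v₃) n≡sm ortho)
  in IsSegre-resp (coset-is-plane indep ortho′ (normal≢0 σ) μ) (P0-plane-segre (σ , ⟨ normal σ , μ ⟩))

theorem6 : ((v1 v2 v3 : F3⁴) → LinIndep3 v1 v2 v3 →
             ((∀ μ → IsSegre (CosetSet v1 v2 v3 μ)) ⇔ KindP0 v1 v2 v3))
           × Exactly24SegreInΩ4
theorem6 = (λ v₁ v₂ v₃ indep → mk⇔ (segre-cosets⇒P0 v₁ v₂ v₃) (P0⇒segre-cosets indep)) , exactly24
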